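{- Let $P_1 \in \mathcal{C}(G_n)$ and $P_2\in\mathcal{S}(P_1)$, with characters $C_1$ and $C_2$ respectively. Let $1 \leq k \leq n+1$. Then $T \in C_1 \cap C_2$ if and only if $T^k \cup \{k\} \in \mathrm{char}(P_1\,\mathrm{stack}_k^1\, P_2)$.
   Context: Let $Q_n=\{1,\dots,n\}$ be a set of $n$ yes/no questions; an outcome on $S\subseteq Q_n$ is an element of $\{0,1\}^{|S|}$, and $X_S$ is the set of outcomes on $S$. A preference matrix on $Q_n$ is a $2^n\times n$ 0-1 matrix whose rows are the $2^n$ outcomes, each exactly once, ordered from most to least preferred. For a nonempty proper $S\subset Q_n$ and outcome $x$ on $Q_n-S$, $P^{[Q_n-S,x]}$ is the submatrix formed by the columns in $S$ and rows with outcome $x$ on $Q_n-S$ (in order); $S$ is separable with respect to $P$ if $P^{[Q_n-S,x]}=P^{[Q_n-S,y]}$ for all $x,y\in X_{Q_n-S}$; $\emptyset$ and $Q_n$ are always separable. The character $\mathrm{char}(P)$ is the set of all subsets of $Q_n$ separable with respect to $P$. $\mathcal{C}(G_n)$ is the set of preference matrices generated by Hamiltonian paths in the $n$-dimensional hypercube graph $G_n$ with Gray code labeling, i.e. preference matrices in which consecutive rows differ in exactly one entry. For $A\in\mathcal{C}(G_n)$, $\mathcal{S}(A)$ is the set of $B\in\mathcal{C}(G_n)$ whose first row equals the last row of $A$. For $B\in\mathcal{S}(A)$ and $k\in\{1,\dots,n+1\}$, $A\,\mathrm{stack}_k^1\,B$ is the $2^{n+1}\times(n+1)$ matrix obtained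 by placing $A$ above $B$ and inserting a new column in position $k$ (shifting later columns right) whose first $2^n$ entries are $1$ and last $2^n$ entries are $0$. For $T\subseteq Q_n$, $T^k=\{q\in T : q<k\}\cup\{q+1 : q\in T \text{ and } q \geq k\}$. -}

module Defs where

open import Data.Bool using (Bool; true; false; _≟_)
open import Data.Nat using (ℕ; suc; _^_)
open import Data.Fin using (Fin; zero; suc)
open import Data.Fin.Subset using (Subset; ∁; ⊥; ⊤; ∣_∣; inside; outside)
open import Data.Vec using (Vec; []; _∷_; insertAt)
open import Data.List using (List; []; _∷_; length; filter; map; _++_; head; last)
open import Data.List.Properties using (≡-dec)
open import Data.List.Relation.Unary.Unique.Propositional using (Unique)
open import Data.List.Relation.Unary.Linked using (Linked)
open import Data.List.Membership.Propositional using (_∈_)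
open import Data.Product using (_×_)
open import Data.Sum using (_⊎_)
open import Relation.Binary.PropositionalEquality using (_≡_)
import Relation.Nullary

-- Questions Q_n are Fin n (question q+1 of the paper is Fin index q).
-- An outcome on Q_n is a Vec Bool n (true = 1, false = 0).
Outcome : ℕ → Set
Outcome n = Vec Bool n

Matrix : ℕ → Set
Matrix n = List (Outcome n)

IsPrefMatrix : (n : ℕ) → Matrix n → Set
IsPrefMatrix n P = (length P ≡ 2 ^ n) × (∀ x → x ∈ P) × Unique P

restrict : {n : ℕ} → Subset n → Outcome n → List Bool
restrict []            []       = []
restrict (true  ∷ S)   (b ∷ r)  = b ∷ restrict S r
restrict (false ∷ S)   (b ∷ r)  = restrict S r

-- P^[Q_n - S, x] : columns in S of the rows whose outcome on Q_n - S is x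
subMatrix : {n : ℕ} → Matrix n → (S : Subset n) → List Bool → List (List Bool)
subMatrix P S x =
  map (restrict S) (filter (λ r → ≡-dec _≟_ (restrict (∁ S) r) x) P)

-- Separability of S w.r.t. P (∅ and Q_n are always separable).
Separable : {n : ℕ} → Matrix n → Subset n → Set
Separable {n} P S =
  (S ≡ ⊥) ⊎ (S ≡ ⊤) ⊎
  (∀ (x y : List Bool) → length x ≡ ∣ ∁ S ∣ → length y ≡ ∣ ∁ S ∣ →
     subMatrix P S x ≡ subMatrix P S y)

char : {n : ℕ} → Matrix n → Subset n → Set
char P S = Separable P S

hamming : {n : ℕ} → Outcome n → Outcome n → ℕ
hamming []       []       = 0
hamming (a ∷ u)  (b ∷ v)  with a ≟ b
... | Relation.Nullary.yes _ = hamming u v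
... | Relation.Nullary.no  _ = suc (hamming u v)

DifferInOne : {n : ℕ} → Outcome n → Outcome n → Set
DifferInOne u v = hamming u v ≡ 1

InC : (n : ℕ) → Matrix n → Set
InC n P = IsPrefMatrix n P × Linked DifferInOne P

InS : (n : ℕ) → Matrix n → Matrix n → Set
InS n A B = InC n B × (head B ≡ last A)

-- A stack_k^1 B ; position k : Fin (suc n) is the paper's k - 1 (0-indexed)
stack : {n : ℕ} → Fin (suc n) → Matrix n → Matrix n → Matrix (suc n)
stack k A B = map (λ r → insertAt r k true) A ++ map (λ r → insertAt r k false) B

-- T^k : indices q < k unchanged, indices q ≥ k shifted to q + 1;
-- i.e. column k is inserted (not a member) and later columns shift right.
shiftSet : {n : ℕ} → Fin (suc n) → Subset n → Subset (suc n)
shiftSet k T = insertAt T k outside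

-- Among the rows of A stack_k B whose outcome off T^k ∪ {k} is x, those coming from A (resp. B)
-- are the rows of A (resp. B) whose outcome off T is x, with the new column's constant bit 1
-- (resp. 0) inserted. So every sub-matrix of the stack is the corresponding sub-matrix of A
-- followed by that of B, and since the inserted bit tells the halves apart, the sub-matrices of
-- the stack all agree iff those of A agree and those of B agree. Of the always-separable sets only
-- T = ∅ needs care: each outcome on Q_n occurs exactly once in a preference matrix, so every
-- P^[Q_n, x] is the same one-row matrix.
module Submission where

open import Defs
open import Data.Bool using (Bool; true; false; not)
open import Data.Bool.Properties using (∨-identityʳ)
import Data.Bool as Bool
open import Data.Empty using (⊥-elim)
open import Data.Fin using (Fin; zero; suc)
open import Data.Fin.Subset using (Subset; _∪_; ⁅_⁆; ∁; ⊥; ⊤; ∣_∣; inside; outside)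
open import Data.Fin.Subset.Properties using (∪-identityʳ; ∣⊥∣≡0; ∣⊤∣≡n)
open import Data.List using (List; []; _∷_; length; filter; map; _++_; [_])
open import Data.List.Membership.Propositional using (_∈_)
open import Data.List.Properties as List
  using (map-++; map-injective; filter-++; filter-≐; filter-accept; filter-reject; filter-none)
import Data.List.Relation.Unary.All as All
open import Data.List.Relation.Unary.AllPairs using (_∷_)
open import Data.List.Relation.Unary.Any using (here; there)
open import Data.List.Relation.Unary.Unique.Propositional using (Unique)
open import Data.Nat using (ℕ; zero; suc)
open import Data.Nat.Properties using (suc-injective)
open import Data.Product using (_×_; _,_; proj₁; proj₂; ∃)
open import Data.Sum using (inj₁; inj₂)
open import Data.Vec using (Vec; []; _∷_; insertAt; lookup; toList)
open import Data.Vec.Properties using (insertAt-lookup; lookup-replicate; map-replicate; map-insertAt)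
import Data.Vec.Properties as Vec
open import Function using (_∘_)
open import Function.Bundles using (_⇔_; mk⇔; Equivalence)
open import Function.Definitions using (Injective)
open import Relation.Binary.PropositionalEquality
  using (_≡_; _≢_; refl; sym; trans; cong; cong₂; module ≡-Reasoning)
open import Relation.Binary.Definitions using (DecidableEquality)
open import Relation.Nullary using (yes; no)

insertAtℕ : ℕ → Bool → List Bool → List Bool
insertAtℕ zero    b l       = b ∷ l
insertAtℕ (suc p) b []      = [ b ]
insertAtℕ (suc p) b (c ∷ l) = c ∷ insertAtℕ p b l

insertAtℕ≢[] : ∀ p b l → insertAtℕ p b l ≢ []
insertAtℕ≢[] zero    b l       ()
insertAtℕ≢[] (suc p) b []      ()
insertAtℕ≢[] (suc p) b (c ∷ l) ()

insertAtℕ-injective : ∀ p {b b′ l l′} → insertAtℕ p b l ≡ insertAtℕ p b′ l′ → b ≡ b′ × l ≡ l′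
insertAtℕ-injective zero    refl = refl , refl
insertAtℕ-injective (suc p) {l = []}    {[]}     refl = refl , refl
insertAtℕ-injective (suc p) {l = []}    {c ∷ l′} e = ⊥-elim (insertAtℕ≢[] p _ l′ (sym (List.∷-injectiveʳ e)))
insertAtℕ-injective (suc p) {l = c ∷ l} {[]}     e = ⊥-elim (insertAtℕ≢[] p _ l (List.∷-injectiveʳ e))
insertAtℕ-injective (suc p) {l = c ∷ l} {c′ ∷ l′} e with List.∷-injective e
... | refl , e′ with insertAtℕ-injective p e′
... | b≡b′ , refl = b≡b′ , refl

++-map-injective : ∀ {A B : Set} {f g : A → B} →
  Injective _≡_ _≡_ f → Injective _≡_ _≡_ g → (∀ a c → f a ≢ g c) →
  ∀ a a′ c c′ → map f a ++ map g c ≡ map f a′ ++ map g c′ → a ≡ a′ × c ≡ c′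
++-map-injective f-inj g-inj f≢g [] [] c c′ e = refl , map-injective g-inj e
++-map-injective f-inj g-inj f≢g [] (a′ ∷ _) [] c′ ()
++-map-injective f-inj g-inj f≢g [] (a′ ∷ _) (c ∷ _) c′ e = ⊥-elim (f≢g a′ c (sym (List.∷-injectiveˡ e)))
++-map-injective f-inj g-inj f≢g (a ∷ _) [] c [] ()
++-map-injective f-inj g-inj f≢g (a ∷ _) [] c (c′ ∷ _) e = ⊥-elim (f≢g a c′ (List.∷-injectiveˡ e))
++-map-injective f-inj g-inj f≢g (a ∷ as) (a′ ∷ as′) c c′ e with List.∷-injective e
... | fa≡fa′ , e′ with f-inj fa≡fa′ | ++-map-injective f-inj g-inj f≢g as as′ c c′ e′
... | refl | refl , c≡c′ = refl , c≡c′

filter-≟-unique : ∀ {A : Set} (_≟_ : DecidableEquality A) {v : A} {xs : List A} →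
  Unique xs → v ∈ xs → filter (_≟ v) xs ≡ [ v ]
filter-≟-unique _≟_ {v} (v∉xs ∷ _) (here refl) =
  trans (filter-accept (_≟ v) refl)
        (cong (v ∷_) (filter-none (_≟ v) (All.map (λ v≢y y≡v → v≢y (sym y≡v)) v∉xs)))
filter-≟-unique _≟_ {v} {x ∷ _} (x∉xs ∷ unique) (there v∈xs) =
  trans (filter-reject (_≟ v) (All.lookup x∉xs v∈xs))
        (filter-≟-unique _≟_ unique v∈xs)

toList-onto : ∀ {A : Set} {n : ℕ} (xs : List A) → length xs ≡ n → ∃ λ (v : Vec A n) → toList v ≡ xs
toList-onto {n = zero}  []       refl = [] , refl
toList-onto {n = suc n} (x ∷ xs) ∣xs∣ with toList-onto xs (suc-injective ∣xs∣)
... | v , v≡xs = x ∷ v , cong (x ∷_) v≡xs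

shiftSet-∪-⁅⁆ : {n : ℕ} (k : Fin (suc n)) (T : Subset n) → shiftSet k T ∪ ⁅ k ⁆ ≡ insertAt T k inside
shiftSet-∪-⁅⁆ zero    T       = cong (inside ∷_) (∪-identityʳ T)
shiftSet-∪-⁅⁆ (suc k) (t ∷ T) = cong₂ _∷_ (∨-identityʳ t) (shiftSet-∪-⁅⁆ k T)

insertAt-inside≢⊥ : {n : ℕ} (k : Fin (suc n)) (T : Subset n) → insertAt T k inside ≢ ⊥
insertAt-inside≢⊥ k T e
  with () ← trans (sym (insertAt-lookup T k inside))
                  (trans (cong (λ S → lookup S k) e) (lookup-replicate k outside))

insertAt-inside≡⊤ : {n : ℕ} (k : Fin (suc n)) (T : Subset n) → insertAt T k inside ≡ ⊤ → T ≡ ⊤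
insertAt-inside≡⊤ zero    T       e = Vec.∷-injectiveʳ e
insertAt-inside≡⊤ (suc k) (t ∷ T) e with Vec.∷-injective e
... | t≡inside , e′ = cong₂ _∷_ t≡inside (insertAt-inside≡⊤ k T e′)

∁-insertAt : {n : ℕ} (S : Subset n) (k : Fin (suc n)) (b : Bool) → ∁ (insertAt S k b) ≡ insertAt (∁ S) k (not b)
∁-insertAt S k b = map-insertAt not b S k

∣insertAt-outside∣ : {n : ℕ} (S : Subset n) (k : Fin (suc n)) → ∣ insertAt S k outside ∣ ≡ ∣ S ∣
∣insertAt-outside∣ S       zero    = refl
∣insertAt-outside∣ (s ∷ S) (suc k) with s
... | true  = cong suc (∣insertAt-outside∣ S k)
... | false = ∣insertAt-outside∣ S k

∣∁insertAt-inside∣ : {n : ℕ} (T : Subset n) (k : Fin (suc n)) → ∣ ∁ (insertAt T k inside) ∣ ≡ ∣ ∁ T ∣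
∣∁insertAt-inside∣ T k = trans (cong ∣_∣ (∁-insertAt T k inside)) (∣insertAt-outside∣ (∁ T) k)

∁⊥≡⊤ : {n : ℕ} → ∁ (⊥ {n}) ≡ ⊤
∁⊥≡⊤ {n} = map-replicate not outside n

∣∁⊤∣≡0 : {n : ℕ} → ∣ ∁ (⊤ {n}) ∣ ≡ 0
∣∁⊤∣≡0 {n} = trans (cong ∣_∣ (map-replicate not inside n)) (∣⊥∣≡0 n)

membersBefore : {n : ℕ} → Fin (suc n) → Subset n → ℕ
membersBefore zero    S           = 0
membersBefore (suc k) (true  ∷ S) = suc (membersBefore k S)
membersBefore (suc k) (false ∷ S) = membersBefore k S

insertColumn : {n : ℕ} → Fin (suc n) → Bool → Outcome n → Outcome (suc n)
insertColumn k b r = insertAt r k b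

restrict-insertAt-outside : {n : ℕ} (S : Subset n) (k : Fin (suc n)) (r : Outcome n) (b : Bool) →
  restrict (insertAt S k outside) (insertColumn k b r) ≡ restrict S r
restrict-insertAt-outside S           zero    r       b = refl
restrict-insertAt-outside (true  ∷ S) (suc k) (c ∷ r) b = cong (c ∷_) (restrict-insertAt-outside S k r b)
restrict-insertAt-outside (false ∷ S) (suc k) (c ∷ r) b = restrict-insertAt-outside S k r b

restrict-insertAt-inside : {n : ℕ} (S : Subset n) (k : Fin (suc n)) (r : Outcome n) (b : Bool) →
  restrict (insertAt S k inside) (insertColumn k b r) ≡ insertAtℕ (membersBefore k S) b (restrict S r)
restrict-insertAt-inside S           zero    r       b = refl
restrict-insertAt-inside (true  ∷ S) (suc k) (c ∷ r) b = cong (c ∷_) (restrict-insertAt-inside S k r b)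
restrict-insertAt-inside (false ∷ S) (suc k) (c ∷ r) b = restrict-insertAt-inside S k r b

restrict-∁insertAt-inside : {n : ℕ} (T : Subset n) (k : Fin (suc n)) (r : Outcome n) (b : Bool) →
  restrict (∁ (insertAt T k inside)) (insertColumn k b r) ≡ restrict (∁ T) r
restrict-∁insertAt-inside T k r b =
  trans (cong (λ S → restrict S (insertColumn k b r)) (∁-insertAt T k inside))
        (restrict-insertAt-outside (∁ T) k r b)

restrict-⊤ : {n : ℕ} (r : Outcome n) → restrict ⊤ r ≡ toList r
restrict-⊤ []      = refl
restrict-⊤ (b ∷ r) = cong (b ∷_) (restrict-⊤ r)

restrict-⊥ : {n : ℕ} (r : Outcome n) → restrict ⊥ r ≡ []
restrict-⊥ []      = refl
restrict-⊥ (b ∷ r) = restrict-⊥ r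

SubMatricesAgree : {n : ℕ} → Matrix n → Subset n → Set
SubMatricesAgree P S = ∀ (x y : List Bool) → length x ≡ ∣ ∁ S ∣ → length y ≡ ∣ ∁ S ∣ →
  subMatrix P S x ≡ subMatrix P S y

subMatrix-insertColumn : {n : ℕ} (k : Fin (suc n)) (T : Subset n) (b : Bool) (x : List Bool) (A : Matrix n) →
  subMatrix (map (insertColumn k b) A) (insertAt T k inside) x
  ≡ map (insertAtℕ (membersBefore k T) b) (subMatrix A T x)
subMatrix-insertColumn k T b x []      = refl
subMatrix-insertColumn k T b x (r ∷ A)
  with List.≡-dec Bool._≟_ (restrict (∁ (insertAt T k inside)) (insertColumn k b r)) x
     | List.≡-dec Bool._≟_ (restrict (∁ T) r) x
     | restrict-∁insertAt-inside T k r b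
... | yes _ | yes _ | _ = cong₂ _∷_ (restrict-insertAt-inside T k r b) (subMatrix-insertColumn k T b x A)
... | no  _ | no  _ | _ = subMatrix-insertColumn k T b x A
... | yes p | no ¬p | q = ⊥-elim (¬p (trans (sym q) p))
... | no ¬p | yes p | q = ⊥-elim (¬p (trans q p))

subMatrix-stack : {n : ℕ} (k : Fin (suc n)) (T : Subset n) (x : List Bool) (A B : Matrix n) →
  subMatrix (stack k A B) (insertAt T k inside) x
  ≡ map (insertAtℕ (membersBefore k T) true) (subMatrix A T x)
    ++ map (insertAtℕ (membersBefore k T) false) (subMatrix B T x)
subMatrix-stack k T x A B = begin
  map (restrict U) (filter D (A′ ++ B′))             ≡⟨ cong (map (restrict U)) (filter-++ D A′ B′) ⟩
  map (restrict U) (filter D A′ ++ filter D B′)      ≡⟨ map-++ (restrict U) (filter D A′) (filter D B′) ⟩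
  subMatrix A′ U x ++ subMatrix B′ U x               ≡⟨ cong₂ _++_ (subMatrix-insertColumn k T true x A)
                                                                   (subMatrix-insertColumn k T false x B) ⟩
  map (insertAtℕ (membersBefore k T) true) (subMatrix A T x)
    ++ map (insertAtℕ (membersBefore k T) false) (subMatrix B T x) ∎
  where
  open ≡-Reasoning
  U = insertAt T k inside
  D = λ r → List.≡-dec Bool._≟_ (restrict (∁ U) r) x
  A′ = map (insertColumn k true) A
  B′ = map (insertColumn k false) B

stack-subMatricesAgree : {n : ℕ} (k : Fin (suc n)) (T : Subset n) (A B : Matrix n) →
  (SubMatricesAgree A T × SubMatricesAgree B T) ⇔ SubMatricesAgree (stack k A B) (insertAt T k inside)
stack-subMatricesAgree k T A B = mk⇔ agree-stack agree-blocks
  where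
  p = membersBefore k T
  ∣∁∣≡ = ∣∁insertAt-inside∣ T k

  agree-stack : SubMatricesAgree A T × SubMatricesAgree B T → SubMatricesAgree (stack k A B) (insertAt T k inside)
  agree-stack (agreeA , agreeB) x y ∣x∣ ∣y∣ = begin
    subMatrix (stack k A B) (insertAt T k inside) x ≡⟨ subMatrix-stack k T x A B ⟩
    map (insertAtℕ p true) (subMatrix A T x) ++ map (insertAtℕ p false) (subMatrix B T x)
      ≡⟨ cong₂ (λ a b → map (insertAtℕ p true) a ++ map (insertAtℕ p false) b)
               (agreeA x y (trans ∣x∣ ∣∁∣≡) (trans ∣y∣ ∣∁∣≡)) (agreeB x y (trans ∣x∣ ∣∁∣≡) (trans ∣y∣ ∣∁∣≡)) ⟩
    map (insertAtℕ p true) (subMatrix A T y) ++ map (insertAtℕ p false) (subMatrix B T y)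
      ≡⟨ subMatrix-stack k T y A B ⟨
    subMatrix (stack k A B) (insertAt T k inside) y ∎
    where open ≡-Reasoning

  agree-halves : SubMatricesAgree (stack k A B) (insertAt T k inside) →
    ∀ x y → length x ≡ ∣ ∁ T ∣ → length y ≡ ∣ ∁ T ∣ →
    subMatrix A T x ≡ subMatrix A T y × subMatrix B T x ≡ subMatrix B T y
  agree-halves agree x y ∣x∣ ∣y∣ =
    ++-map-injective (proj₂ ∘ insertAtℕ-injective p) (proj₂ ∘ insertAtℕ-injective p)
      (λ _ _ e → true≢false (proj₁ (insertAtℕ-injective p e)))
      _ _ _ _
      (trans (sym (subMatrix-stack k T x A B))
        (trans (agree x y (trans ∣x∣ (sym ∣∁∣≡)) (trans ∣y∣ (sym ∣∁∣≡))) (subMatrix-stack k T y A B)))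
    where
    true≢false : true ≢ false
    true≢false ()

  agree-blocks : SubMatricesAgree (stack k A B) (insertAt T k inside) → SubMatricesAgree A T × SubMatricesAgree B T
  agree-blocks agree = (λ x y ∣x∣ ∣y∣ → proj₁ (agree-halves agree x y ∣x∣ ∣y∣))
                     , (λ x y ∣x∣ ∣y∣ → proj₂ (agree-halves agree x y ∣x∣ ∣y∣))

subMatrix-∅ : {n : ℕ} (P : Matrix n) → IsPrefMatrix n P →
  (x : List Bool) → length x ≡ n → subMatrix P ⊥ x ≡ [ [] ]
subMatrix-∅ {n} P (_ , complete , unique) x ∣x∣ with toList-onto x ∣x∣
... | v , refl = begin
  map (restrict ⊥) (filter (λ r → List.≡-dec Bool._≟_ (restrict (∁ ⊥) r) (toList v)) P)
    ≡⟨ cong (map (restrict ⊥)) (filter-≐ _ _ (selects-v , selected-v) P) ⟩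
  map (restrict ⊥) (filter (_≟ᵥ v) P)  ≡⟨ cong (map (restrict ⊥)) (filter-≟-unique _≟ᵥ_ unique (complete v)) ⟩
  [ restrict ⊥ v ]                      ≡⟨ cong [_] (restrict-⊥ v) ⟩
  [ [] ]                                ∎
  where
  open ≡-Reasoning
  _≟ᵥ_ : DecidableEquality (Outcome n)
  _≟ᵥ_ = Vec.≡-dec Bool._≟_
  restrict-∁⊥ : (r : Outcome n) → restrict (∁ ⊥) r ≡ toList r
  restrict-∁⊥ r = trans (cong (λ S → restrict S r) ∁⊥≡⊤) (restrict-⊤ r)
  selects-v : ∀ {r} → restrict (∁ ⊥) r ≡ toList v → r ≡ v
  selects-v {r} e =
    trans (sym (Vec.cast-is-id refl r)) (Vec.toList-injective refl r v (trans (sym (restrict-∁⊥ r)) e))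
  selected-v : ∀ {r} → r ≡ v → restrict (∁ ⊥) r ≡ toList v
  selected-v refl = restrict-∁⊥ v

separable⇒subMatricesAgree : {n : ℕ} (P : Matrix n) (S : Subset n) →
  IsPrefMatrix n P → Separable P S → SubMatricesAgree P S
separable⇒subMatricesAgree {n} P S pref (inj₁ refl) x y ∣x∣ ∣y∣ =
  trans (subMatrix-∅ P pref x (trans ∣x∣ n-complement)) (sym (subMatrix-∅ P pref y (trans ∣y∣ n-complement)))
  where
  n-complement : ∣ ∁ (⊥ {n}) ∣ ≡ n
  n-complement = trans (cong ∣_∣ (∁⊥≡⊤ {n})) (∣⊤∣≡n n)
separable⇒subMatricesAgree {n} P S pref (inj₂ (inj₁ refl)) x y ∣x∣ ∣y∣ =
  cong (subMatrix P ⊤) (trans (empty x ∣x∣) (sym (empty y ∣y∣)))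
  where
  empty : ∀ z → length z ≡ ∣ ∁ (⊤ {n}) ∣ → z ≡ []
  empty []      _   = refl
  empty (_ ∷ _) ∣z∣ with () ← trans ∣z∣ (∣∁⊤∣≡0 {n})
separable⇒subMatricesAgree P S pref (inj₂ (inj₂ agree)) = agree

lemma7 : (n : ℕ) (P₁ P₂ : Matrix n) → InC n P₁ → InS n P₁ P₂ →
    (k : Fin (suc n)) (T : Subset n) →
    (char P₁ T × char P₂ T) ⇔ char (stack k P₁ P₂) (shiftSet k T ∪ ⁅ k ⁆)
lemma7 n P₁ P₂ (pref₁ , _) ((pref₂ , _) , _) k T rewrite shiftSet-∪-⁅⁆ k T =
  mk⇔ (inj₂ ∘ inj₂ ∘ Equivalence.to (stack-subMatricesAgree k T P₁ P₂) ∘ agree) separable-blocks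
  where
  agree : char P₁ T × char P₂ T → SubMatricesAgree P₁ T × SubMatricesAgree P₂ T
  agree (sep₁ , sep₂) =
    separable⇒subMatricesAgree P₁ T pref₁ sep₁ , separable⇒subMatricesAgree P₂ T pref₂ sep₂
  separable-blocks : char (stack k P₁ P₂) (insertAt T k inside) → char P₁ T × char P₂ T
  separable-blocks (inj₁ U≡∅)        = ⊥-elim (insertAt-inside≢⊥ k T U≡∅)
  separable-blocks (inj₂ (inj₁ U≡⊤)) = inj₂ (inj₁ T≡⊤) , inj₂ (inj₁ T≡⊤)
    where T≡⊤ = insertAt-inside≡⊤ k T U≡⊤
  separable-blocks (inj₂ (inj₂ agreeU)) with Equivalence.from (stack-subMatricesAgree k T P₁ P₂) agreeU
  ... | agree₁ , agree₂ = inj₂ (inj₂ agree₁) , inj₂ (inj₂ agree₂)
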